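{- For all primes $p$, all integers $m_1,m_2,k$ and all integers $r \geq 1$, \[ \binom{p^r m_1 + p^r m_2 - k - 1}{p^r m_1} \equiv \binom{p^{r-1}m_1 + p^{r-1}m_2 - \lfloor k/p\rfloor - 1}{p^{r-1}m_1} \pmod{p^r}. \]
   Context: For arbitrary integers $n,k$ the binomial coefficient is defined by $\binom{n}{k} = \lim_{z\to 0} \frac{\Gamma(z+n+1)}{\Gamma(z+k+1)\Gamma(z+n-k+1)}$, a finite integer for all $n,k\in\mathbb{Z}$. $\lfloor x\rfloor$ denotes the floor function. -}

module Defs where

open import Data.Nat using (ℕ; _<ᵇ_; _∸_) renaming (_+_ to _+ℕ_)
open import Data.Nat.Combinatorics using (_C_)
open import Data.Bool using (if_then_else_)
open import Data.Integer using (ℤ; +_; -[1+_]; -1ℤ; _*_; _^_)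

-- Binomial coefficient for arbitrary integers n, k, defined as
--   lim_{z→0} Γ(z+n+1) / (Γ(z+k+1) Γ(z+n-k+1)).
-- Evaluating the limit (residues of Γ at non-positive integers) gives:
--   n ≥ 0          : usual binomial (0 if k < 0 or k > n)
--   n < 0 ≤ k      : (-1)^k     * C(k-n-1, k)
--   k ≤ n < 0      : (-1)^(n-k) * C(-k-1, n-k)
--   n < k < 0      : 0
-- Here -[1+ a ] is the integer -(a+1).
binomℤ : ℤ → ℤ → ℤ
binomℤ (+ n)     (+ k)     = + (n C k)
binomℤ (+ n)     -[1+ k ]  = + 0
binomℤ -[1+ n ]  (+ k)     = (-1ℤ ^ k) * + ((n +ℕ k) C k)
binomℤ -[1+ n ]  -[1+ k ]  =
  if k <ᵇ n then + 0 else (-1ℤ ^ (k ∸ n)) * + (k C (k ∸ n))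

module Submission where

-- Write p^r = p·n with n = p^(r-1), and k = s + t·p with 0 ≤ s < p; put e = p-1-s.
-- Then the top of the left binomial is p·T + e with T = n·m₁ + n·m₂ - t - 1 and its
-- bottom is p·K with K = n·m₁, so the theorem is the congruence (mod p·n)
--     C(pT + e, pK) ≡ C(T, K)      for all T, K with n ∣ K and 0 ≤ e < p.
-- Everything is computed through falling factorials, C(x, L)·L! = x(x-1)⋯(x-L+1).
--  * Removing the multiples of p from a falling factorial gives the exact identity
--      fall(p·x, b·p) = p^b · fall(x, b) · G(x, b),
--    where G(x, b) is a product of integers prime to p which, modulo p·n, depends only on
--    x mod n, and not on x at all when n ∣ b.  Hence C(pa, pb) ≡ C(a, b) whenever
--    n ∣ b or n ∣ a - b.
--  * Adding e < p to the top (and, when n ∣ a - b, also to the bottom) only multiplies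
--    both binomials by units mod p that agree modulo p·n.
--  * For K ≥ 0 these two facts give the claim directly.  For K < 0 either both sides
--    vanish, or the reflection C(x, y) = C(x, x - y) (valid for y ≤ x < 0) reduces the
--    claim to the case "n ∣ a - b" above.
-- Units are cancelled modulo p^r by iterating Euclid's lemma.

open import Defs

module BinomialCongruence where

  open import Data.Nat as ℕ using (ℕ; zero; suc; _!)
  import Data.Nat.Properties as ℕP
  import Data.Nat.Divisibility as ℕD
  open import Data.Nat.Combinatorics using (_C_; nCk+nC[k+1]≡[n+1]C[k+1]; nCn≡1)
  open import Data.Nat.Primality using (Prime; euclidsLemma; prime⇒nonZero; prime⇒nonTrivial)
  open import Data.Integer
    using (ℤ; +_; -[1+_]; _+_; _-_; _*_; -_; _^_; 0ℤ; 1ℤ; -1ℤ; ∣_∣)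
  open import Data.Integer.Properties
    using (*-identityˡ; *-identityʳ; *-assoc; *-comm; +-identityʳ; *-zeroʳ; *-cancelˡ-≡;
           pos-+; pos-*; abs-*; m-n≡m⊖n; ⊖-≥; neg-distribʳ-*; i*j≢0)
  open import Data.Integer.Tactic.RingSolver using (solve-∀)
  open import Data.Integer.Divisibility.Signed
    using (_∣_; divides; ∣ᵤ⇒∣; ∣⇒∣ᵤ; ∣-refl; ∣m∣n⇒∣m+n; ∣m⇒∣-m; ∣m∣n⇒∣m-n; ∣m+n∣m⇒∣n;
           ∣n⇒∣m*n; ∣m⇒∣m*n; *-monoʳ-∣)
  open import Data.Integer.DivMod using (_/ℕ_; _%ℕ_; a≡a%ℕn+[a/ℕn]*n; n%ℕd<d)
  open import Level using (0ℓ)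
  open import Relation.Binary.Bundles using (Setoid)
  import Relation.Binary.Reasoning.Setoid as SetoidReasoning
  import Data.Nat.Tactic.RingSolver as ℕSolver
  open import Data.Sum using (_⊎_; inj₁; inj₂)
  open import Data.Empty using (⊥-elim)
  open import Data.Bool using (true; false)
  open import Relation.Nullary using (¬_; yes; no)
  open import Relation.Binary.PropositionalEquality
    using (_≡_; refl; sym; trans; cong; cong₂; subst; subst₂; module ≡-Reasoning)

  fall : ℤ → ℕ → ℤ
  fall x zero    = 1ℤ
  fall x (suc L) = x * fall (x - 1ℤ) L

  fall-+ : ∀ x L₁ L₂ → fall x (L₁ ℕ.+ L₂) ≡ fall x L₁ * fall (x - + L₁) L₂
  fall-+ x zero L₂ = sym (trans (*-identityˡ _) (cong (λ y → fall y L₂) (+-identityʳ x)))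
  fall-+ x (suc L₁) L₂ = begin
    x * fall (x - 1ℤ) (L₁ ℕ.+ L₂)                      ≡⟨ cong (x *_) (fall-+ (x - 1ℤ) L₁ L₂) ⟩
    x * (fall (x - 1ℤ) L₁ * fall (x - 1ℤ - + L₁) L₂)   ≡⟨ cong (λ y → x * (fall (x - 1ℤ) L₁ * fall y L₂)) (shift x (+ L₁)) ⟩
    x * (fall (x - 1ℤ) L₁ * fall (x - + suc L₁) L₂)    ≡⟨ sym (*-assoc x _ _) ⟩
    x * fall (x - 1ℤ) L₁ * fall (x - + suc L₁) L₂      ∎
    where
    open ≡-Reasoning
    shift : ∀ x l → x - 1ℤ - l ≡ x - (1ℤ + l)
    shift = solve-∀

  fall-last : ∀ x L → fall x (suc L) ≡ fall x L * (x - + L)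
  fall-last x L = begin
    fall x (suc L)               ≡⟨ cong (fall x) (ℕP.+-comm 1 L) ⟩
    fall x (L ℕ.+ 1)             ≡⟨ fall-+ x L 1 ⟩
    fall x L * ((x - + L) * 1ℤ)  ≡⟨ cong (fall x L *_) (*-identityʳ _) ⟩
    fall x L * (x - + L)         ∎
    where open ≡-Reasoning

  fall-peel : ∀ x e K → fall (x + + e) (e ℕ.+ K) ≡ fall (x + + e) e * fall x K
  fall-peel x e K = trans (fall-+ (x + + e) e K) (cong (λ y → fall (x + + e) e * fall y K) (add-sub x (+ e)))
    where
    add-sub : ∀ x e → x + e - e ≡ x
    add-sub = solve-∀

  fall-neg : ∀ y L → fall (- y) L ≡ (-1ℤ ^ L) * fall (y + + L - 1ℤ) L
  fall-neg y zero = refl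
  fall-neg y (suc L) = begin
    (- y) * fall (- y - 1ℤ) L
      ≡⟨ cong (λ z → (- y) * fall z L) (neg-suc y) ⟩
    (- y) * fall (- (y + 1ℤ)) L
      ≡⟨ cong ((- y) *_) (fall-neg (y + 1ℤ) L) ⟩
    (- y) * ((-1ℤ ^ L) * fall (y + 1ℤ + + L - 1ℤ) L)
      ≡⟨ cong (λ z → (- y) * ((-1ℤ ^ L) * fall z L)) (reassoc y (+ L)) ⟩
    (- y) * ((-1ℤ ^ L) * fall (y + + suc L - 1ℤ) L)
      ≡⟨ regroup y (+ L) (-1ℤ ^ L) (fall (y + + suc L - 1ℤ) L) ⟩
    (-1ℤ ^ suc L) * (fall (y + + suc L - 1ℤ) L * (y + + suc L - 1ℤ - + L))
      ≡⟨ cong ((-1ℤ ^ suc L) *_) (sym (fall-last _ L)) ⟩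
    (-1ℤ ^ suc L) * fall (y + + suc L - 1ℤ) (suc L) ∎
    where
    open ≡-Reasoning
    neg-suc : ∀ y → - y - 1ℤ ≡ - (y + 1ℤ)
    neg-suc = solve-∀
    reassoc : ∀ y l → y + 1ℤ + l - 1ℤ ≡ y + (1ℤ + l) - 1ℤ
    reassoc = solve-∀
    regroup : ∀ y l s f → (- y) * (s * f) ≡ (-1ℤ * s) * (f * (y + (1ℤ + l) - 1ℤ - l))
    regroup = solve-∀

  binom-nat-fall : ∀ m K → + (m C K) * + (K !) ≡ fall (+ m) K
  binom-nat-fall m zero = refl
  binom-nat-fall zero (suc K) = refl
  binom-nat-fall (suc m) (suc K) = begin
    + (suc m C suc K) * + (suc K !)
      ≡⟨ cong₂ _*_ (trans (cong +_ (sym (nCk+nC[k+1]≡[n+1]C[k+1] m K))) (pos-+ (m C K) _))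
                   (pos-* (suc K) (K !)) ⟩
    (+ (m C K) + + (m C suc K)) * ((1ℤ + + K) * + (K !))
      ≡⟨ pascal (+ (m C K)) (+ (m C suc K)) (+ K) (+ (K !)) ⟩
    (+ (m C K) * + (K !)) * (1ℤ + + K) + + (m C suc K) * ((1ℤ + + K) * + (K !))
      ≡⟨ cong₂ _+_ (cong (_* (1ℤ + + K)) (binom-nat-fall m K))
                   (trans (cong (+ (m C suc K) *_) (sym (pos-* (suc K) (K !)))) (binom-nat-fall m (suc K))) ⟩
    fall (+ m) K * (1ℤ + + K) + fall (+ m) (suc K)
      ≡⟨ cong (_+_ (fall (+ m) K * (1ℤ + + K))) (fall-last (+ m) K) ⟩
    fall (+ m) K * (1ℤ + + K) + fall (+ m) K * (+ m - + K)
      ≡⟨ collect (fall (+ m) K) (+ K) (+ m) ⟩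
    fall (+ suc m) (suc K) ∎
    where
    open ≡-Reasoning
    pascal : ∀ c d k f → (c + d) * ((1ℤ + k) * f) ≡ (c * f) * (1ℤ + k) + d * ((1ℤ + k) * f)
    pascal = solve-∀
    collect : ∀ F k m → F * (1ℤ + k) + F * (m - k) ≡ (1ℤ + m) * F
    collect = solve-∀

  binom-fall : ∀ x K → binomℤ x (+ K) * + (K !) ≡ fall x K
  binom-fall (+ m) K = binom-nat-fall m K
  binom-fall -[1+ A ] K = begin
    (-1ℤ ^ K) * + ((A ℕ.+ K) C K) * + (K !)    ≡⟨ *-assoc (-1ℤ ^ K) _ _ ⟩
    (-1ℤ ^ K) * (+ ((A ℕ.+ K) C K) * + (K !))  ≡⟨ cong ((-1ℤ ^ K) *_) (binom-nat-fall (A ℕ.+ K) K) ⟩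
    (-1ℤ ^ K) * fall (+ (A ℕ.+ K)) K           ≡⟨ cong (λ z → (-1ℤ ^ K) * fall z K) (trans (pos-+ A K) (sym (tidy (+ A) (+ K)))) ⟩
    (-1ℤ ^ K) * fall (+ suc A + + K - 1ℤ) K    ≡⟨ sym (fall-neg (+ suc A) K) ⟩
    fall -[1+ A ] K                            ∎
    where
    open ≡-Reasoning
    tidy : ∀ a k → 1ℤ + a + k - 1ℤ ≡ a + k
    tidy = solve-∀

  factorial-fall : ∀ K → + (K !) ≡ fall (+ K) K
  factorial-fall K = trans (sym (*-identityˡ _))
    (trans (cong (λ c → + c * + (K !)) (sym (nCn≡1 K))) (binom-nat-fall K K))

  factorial-+ : ∀ K e → + ((K ℕ.+ e) !) ≡ fall (+ (K ℕ.+ e)) e * + (K !)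
  factorial-+ K e = begin
    + ((K ℕ.+ e) !)                          ≡⟨ factorial-fall (K ℕ.+ e) ⟩
    fall (+ (K ℕ.+ e)) (K ℕ.+ e)             ≡⟨ cong₂ fall (pos-+ K e) (ℕP.+-comm K e) ⟩
    fall (+ K + + e) (e ℕ.+ K)               ≡⟨ fall-peel (+ K) e K ⟩
    fall (+ K + + e) e * fall (+ K) K        ≡⟨ cong₂ (λ y z → fall y e * z) (sym (pos-+ K e)) (sym (factorial-fall K)) ⟩
    fall (+ (K ℕ.+ e)) e * + (K !)           ∎
    where open ≡-Reasoning

  -- Two identities comparing C(x + e, ·) with C(x, K), both obtained by writing
  -- fall (x + e) (e + K) in two ways and cancelling K!.
  binom-top-shift : ∀ x K e →
    binomℤ (x + + e) (+ K) * fall (x + + e - + K) e ≡ binomℤ x (+ K) * fall (x + + e) e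
  binom-top-shift x K e = *-cancelˡ-≡ (+ (K !)) _ _ {{K ℕP.!≢0}} (begin
    + (K !) * (binomℤ (x + + e) (+ K) * fall (x + + e - + K) e)
      ≡⟨ rotate (+ (K !)) (binomℤ (x + + e) (+ K)) (fall (x + + e - + K) e) ⟩
    binomℤ (x + + e) (+ K) * + (K !) * fall (x + + e - + K) e
      ≡⟨ cong (_* fall (x + + e - + K) e) (binom-fall (x + + e) K) ⟩
    fall (x + + e) K * fall (x + + e - + K) e
      ≡⟨ sym (fall-+ (x + + e) K e) ⟩
    fall (x + + e) (K ℕ.+ e)
      ≡⟨ cong (fall (x + + e)) (ℕP.+-comm K e) ⟩
    fall (x + + e) (e ℕ.+ K)
      ≡⟨ fall-peel x e K ⟩
    fall (x + + e) e * fall x K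
      ≡⟨ cong (fall (x + + e) e *_) (sym (binom-fall x K)) ⟩
    fall (x + + e) e * (binomℤ x (+ K) * + (K !))
      ≡⟨ rotate′ (fall (x + + e) e) (binomℤ x (+ K)) (+ (K !)) ⟩
    + (K !) * (binomℤ x (+ K) * fall (x + + e) e) ∎)
    where
    open ≡-Reasoning
    rotate : ∀ f b u → f * (b * u) ≡ b * f * u
    rotate = solve-∀
    rotate′ : ∀ u b f → u * (b * f) ≡ f * (b * u)
    rotate′ = solve-∀

  binom-both-shift : ∀ x K e →
    binomℤ (x + + e) (+ (K ℕ.+ e)) * fall (+ (K ℕ.+ e)) e ≡ binomℤ x (+ K) * fall (x + + e) e
  binom-both-shift x K e = *-cancelˡ-≡ (+ (K !)) _ _ {{K ℕP.!≢0}} (begin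
    + (K !) * (binomℤ (x + + e) (+ (K ℕ.+ e)) * fall (+ (K ℕ.+ e)) e)
      ≡⟨ rotate (+ (K !)) (binomℤ (x + + e) (+ (K ℕ.+ e))) (fall (+ (K ℕ.+ e)) e) ⟩
    binomℤ (x + + e) (+ (K ℕ.+ e)) * (fall (+ (K ℕ.+ e)) e * + (K !))
      ≡⟨ cong (binomℤ (x + + e) (+ (K ℕ.+ e)) *_) (sym (factorial-+ K e)) ⟩
    binomℤ (x + + e) (+ (K ℕ.+ e)) * + ((K ℕ.+ e) !)
      ≡⟨ binom-fall (x + + e) (K ℕ.+ e) ⟩
    fall (x + + e) (K ℕ.+ e)
      ≡⟨ cong (fall (x + + e)) (ℕP.+-comm K e) ⟩
    fall (x + + e) (e ℕ.+ K)
      ≡⟨ fall-peel x e K ⟩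
    fall (x + + e) e * fall x K
      ≡⟨ cong (fall (x + + e) e *_) (sym (binom-fall x K)) ⟩
    fall (x + + e) e * (binomℤ x (+ K) * + (K !))
      ≡⟨ rotate′ (fall (x + + e) e) (binomℤ x (+ K)) (+ (K !)) ⟩
    + (K !) * (binomℤ x (+ K) * fall (x + + e) e) ∎)
    where
    open ≡-Reasoning
    rotate : ∀ f b u → f * (b * u) ≡ b * (u * f)
    rotate = solve-∀
    rotate′ : ∀ u b f → u * (b * f) ≡ f * (b * u)
    rotate′ = solve-∀

  binom-neg-vanish : ∀ A K → K ℕ.< A → binomℤ -[1+ A ] -[1+ K ] ≡ 0ℤ
  binom-neg-vanish A K K<A with K ℕ.<ᵇ A | ℕP.<⇒<ᵇ K<A
  ... | true | _ = refl

  binom-neg-reflect : ∀ A K → A ℕ.≤ K → binomℤ -[1+ A ] -[1+ K ] ≡ binomℤ -[1+ A ] (+ (K ℕ.∸ A))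
  binom-neg-reflect A K A≤K with K ℕ.<ᵇ A | ℕP.<ᵇ⇒< K A
  ... | false | _ = cong (λ m → (-1ℤ ^ (K ℕ.∸ A)) * + (m C (K ℕ.∸ A))) (sym (ℕP.m+[n∸m]≡n A≤K))
  ... | true | K<A = ⊥-elim (ℕP.<⇒≱ (K<A _) A≤K)

  infix 4 _≡_mod_
  record _≡_mod_ (x y m : ℤ) : Set where
    constructor mod-by
    field difference : m ∣ x - y
  open _≡_mod_

  ≡⇒≡-mod : ∀ {m x y} → x ≡ y → x ≡ y mod m
  ≡⇒≡-mod {m} {x} refl = mod-by (divides 0ℤ (self-difference x m))
    where
    self-difference : ∀ x m → x - x ≡ 0ℤ * m
    self-difference = solve-∀

  mod-refl : ∀ {m x} → x ≡ x mod m
  mod-refl = ≡⇒≡-mod refl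

  mod-sym : ∀ {m x y} → x ≡ y mod m → y ≡ x mod m
  mod-sym {m} {x} {y} (mod-by d) = mod-by (subst (m ∣_) (flip x y) (∣m⇒∣-m d))
    where
    flip : ∀ x y → - (x - y) ≡ y - x
    flip = solve-∀

  mod-trans : ∀ {m x y z} → x ≡ y mod m → y ≡ z mod m → x ≡ z mod m
  mod-trans {m} {x} {y} {z} (mod-by d) (mod-by d′) = mod-by (subst (m ∣_) (telescope x y z) (∣m∣n⇒∣m+n d d′))
    where
    telescope : ∀ x y z → (x - y) + (y - z) ≡ x - z
    telescope = solve-∀

  mod-+ : ∀ {m x y u v} → x ≡ y mod m → u ≡ v mod m → x + u ≡ y + v mod m
  mod-+ {m} {x} {y} {u} {v} (mod-by d) (mod-by d′) = mod-by (subst (m ∣_) (split x y u v) (∣m∣n⇒∣m+n d d′))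
    where
    split : ∀ x y u v → (x - y) + (u - v) ≡ (x + u) - (y + v)
    split = solve-∀

  mod-- : ∀ {m x y u v} → x ≡ y mod m → u ≡ v mod m → x - u ≡ y - v mod m
  mod-- {m} {x} {y} {u} {v} (mod-by d) (mod-by d′) = mod-by (subst (m ∣_) (split x y u v) (∣m∣n⇒∣m-n d d′))
    where
    split : ∀ x y u v → (x - y) - (u - v) ≡ (x - u) - (y - v)
    split = solve-∀

  mod-* : ∀ {m x y u v} → x ≡ y mod m → u ≡ v mod m → x * u ≡ y * v mod m
  mod-* {m} {x} {y} {u} {v} (mod-by d) (mod-by d′) =
    mod-by (subst (m ∣_) (split x y u v) (∣m∣n⇒∣m+n (∣n⇒∣m*n x d′) (∣m⇒∣m*n v d)))
    where
    split : ∀ x y u v → x * (u - v) + (x - y) * v ≡ x * u - y * v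
    split = solve-∀

  mod-*ˡ : ∀ c {m x y} → x ≡ y mod m → c * x ≡ c * y mod m
  mod-*ˡ c = mod-* (mod-refl {x = c})

  mod-scale : ∀ c {m x y} → x ≡ y mod m → c * x ≡ c * y mod c * m
  mod-scale c {m} {x} {y} (mod-by d) = mod-by (subst (c * m ∣_) (distrib c x y) (*-monoʳ-∣ c d))
    where
    distrib : ∀ c x y → c * (x - y) ≡ c * x - c * y
    distrib = solve-∀

  ∣⇒≡0-mod : ∀ {m x} → m ∣ x → x ≡ 0ℤ mod m
  ∣⇒≡0-mod {m} {x} m∣x = mod-by (subst (m ∣_) (sym (+-identityʳ x)) m∣x)

  difference-mod : ∀ {m x y z} → x - y ≡ z → z ≡ 0ℤ mod m → x ≡ y mod m
  difference-mod {m} {z = z} x-y≡z (mod-by m∣z) = mod-by (subst (m ∣_) (trans (+-identityʳ z) (sym x-y≡z)) m∣z)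

  mod-setoid : ℤ → Setoid 0ℓ 0ℓ
  mod-setoid m = record
    { Carrier       = ℤ
    ; _≈_           = λ x y → x ≡ y mod m
    ; isEquivalence = record { refl = mod-refl ; sym = mod-sym ; trans = mod-trans }
    }

  fall-mod : ∀ {m x y} L → x ≡ y mod m → fall x L ≡ fall y L mod m
  fall-mod zero    x≡y = mod-refl
  fall-mod (suc L) x≡y = mod-* x≡y (fall-mod L (mod-- x≡y mod-refl))

  prime^-cancel : ∀ {p} → Prime p → ∀ j a b → p ℕ.^ j ℕD.∣ a ℕ.* b → ¬ p ℕD.∣ b → p ℕ.^ j ℕD.∣ a
  prime^-cancel pp zero a b _ _ = ℕD.1∣ a
  prime^-cancel {p} pp (suc j) a b p^[1+j]∣ab p∤b with euclidsLemma a b pp (ℕD.∣-trans (ℕD.m∣m*n (p ℕ.^ j)) p^[1+j]∣ab)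
  ... | inj₂ p∣b = ⊥-elim (p∤b p∣b)
  ... | inj₁ (ℕD.divides q refl) =
    subst (p ℕ.^ suc j ℕD.∣_) (ℕP.*-comm p q) (ℕD.*-monoʳ-∣ p (prime^-cancel pp j q b p^j∣qb p∤b))
    where
    instance _ = prime⇒nonZero pp
    p^j∣qb : p ℕ.^ j ℕD.∣ q ℕ.* b
    p^j∣qb = ℕD.*-cancelˡ-∣ p (subst (p ℕ.* p ℕ.^ j ℕD.∣_) (ℕP.*-assoc p q b)
                               (subst (λ c → p ℕ.^ suc j ℕD.∣ c ℕ.* b) (ℕP.*-comm q p) p^[1+j]∣ab))

  mod-cancel : ∀ {p j x y u} → Prime p → x * u ≡ y * u mod + (p ℕ.^ j) → ¬ (+ p ∣ u) → x ≡ y mod + (p ℕ.^ j)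
  mod-cancel {p} {j} {x} {y} {u} pp (mod-by d) p∤u =
    mod-by (∣ᵤ⇒∣ (prime^-cancel pp j ∣ x - y ∣ ∣ u ∣ p^j∣[x-y]u (λ p∣u → p∤u (∣ᵤ⇒∣ p∣u))))
    where
    factor : ∀ x y u → x * u - y * u ≡ (x - y) * u
    factor = solve-∀
    p^j∣[x-y]u : p ℕ.^ j ℕD.∣ ∣ x - y ∣ ℕ.* ∣ u ∣
    p^j∣[x-y]u = subst (p ℕ.^ j ℕD.∣_) (abs-* (x - y) u) (∣⇒∣ᵤ (subst (+ (p ℕ.^ j) ∣_) (factor x y u) d))

  prime-to-* : ∀ {p u v} → Prime p → ¬ (+ p ∣ u) → ¬ (+ p ∣ v) → ¬ (+ p ∣ u * v)
  prime-to-* {p} {u} {v} pp p∤u p∤v p∣uv with euclidsLemma ∣ u ∣ ∣ v ∣ pp (subst (p ℕD.∣_) (abs-* u v) (∣⇒∣ᵤ p∣uv))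
  ... | inj₁ p∣u = p∤u (∣ᵤ⇒∣ p∣u)
  ... | inj₂ p∣v = p∤v (∣ᵤ⇒∣ p∣v)

  prime-to-1 : ∀ {p} → Prime p → ¬ (+ p ∣ 1ℤ)
  prime-to-1 pp p∣1 = ℕ.nonTrivial⇒≢1 {{prime⇒nonTrivial pp}} (ℕD.∣1⇒≡1 (∣⇒∣ᵤ p∣1))

  prime-to-fall : ∀ {p} → Prime p → ∀ q e → e ℕ.< p → ¬ (+ p ∣ fall (+ p * q + + e) e)
  prime-to-fall pp q zero    _   = prime-to-1 pp
  prime-to-fall {p} pp q (suc e) e<p =
    prime-to-* pp top (subst (λ z → ¬ (+ p ∣ fall z e)) (sym (drop-one (+ p * q) (+ e)))
                        (prime-to-fall pp q e (ℕP.<-trans (ℕP.n<1+n e) e<p)))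
    where
    drop-one : ∀ a e → a + (1ℤ + e) - 1ℤ ≡ a + e
    drop-one = solve-∀
    top : ¬ (+ p ∣ + p * q + + suc e)
    top p∣top = ℕP.<⇒≱ e<p (ℕD.∣⇒≤ (∣⇒∣ᵤ (∣m+n∣m⇒∣n p∣top (∣m⇒∣m*n q ∣-refl))))

  -- Separating the multiples of p from a falling factorial

  module Splitting {p′ : ℕ} (pp : Prime (suc p′)) where

    p : ℕ
    p = suc p′

    P : ℤ
    P = + p

    pos-*p : ∀ b → + (b ℕ.* p) ≡ P * + b
    pos-*p b = trans (pos-* b p) (*-comm (+ b) P)

    -- W q = (pq-1)(pq-2)⋯(pq-p+1), the product of the p-1 integers strictly between
    -- p(q-1) and pq; all of them are prime to p.
    W : ℤ → ℤ
    W q = fall (P * q - 1ℤ) p′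

    W-prime-to-p : ∀ q → ¬ (P ∣ W q)
    W-prime-to-p q = subst (λ z → ¬ (P ∣ fall z p′)) (sym (rewrite-top (+ p′) q))
                       (prime-to-fall pp (q - 1ℤ) p′ (ℕP.n<1+n p′))
      where
      rewrite-top : ∀ a q → (1ℤ + a) * q - 1ℤ ≡ (1ℤ + a) * (q - 1ℤ) + a
      rewrite-top = solve-∀

    -- G x b = W x · W (x-1) ⋯ W (x-b+1): the part of fall (p·x) (b·p) prime to p.
    G : ℤ → ℕ → ℤ
    G x zero    = 1ℤ
    G x (suc b) = W x * G (x - 1ℤ) b

    G-prime-to-p : ∀ x b → ¬ (P ∣ G x b)
    G-prime-to-p x zero    = prime-to-1 pp
    G-prime-to-p x (suc b) = prime-to-* pp (W-prime-to-p x) (G-prime-to-p (x - 1ℤ) b)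

    G-last : ∀ x b → G x (suc b) ≡ G x b * W (x - + b)
    G-last x zero = trans (*-identityʳ (W x)) (trans (cong W (sym (+-identityʳ x))) (sym (*-identityˡ _)))
    G-last x (suc b) = begin
      W x * G (x - 1ℤ) (suc b)                 ≡⟨ cong (W x *_) (G-last (x - 1ℤ) b) ⟩
      W x * (G (x - 1ℤ) b * W (x - 1ℤ - + b))  ≡⟨ cong (λ z → W x * (G (x - 1ℤ) b * W z)) (shift x (+ b)) ⟩
      W x * (G (x - 1ℤ) b * W (x - + suc b))   ≡⟨ sym (*-assoc (W x) _ _) ⟩
      W x * G (x - 1ℤ) b * W (x - + suc b)     ∎
      where
      open ≡-Reasoning
      shift : ∀ x l → x - 1ℤ - l ≡ x - (1ℤ + l)
      shift = solve-∀

    -- fall (p·x) (b·p) = p^b · fall x b · G x b: each block of p consecutive factors is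
    -- one multiple of p, p·(x - j), followed by the p-1 factors of W (x - j).
    fall-p-split : ∀ x b → fall (P * x) (b ℕ.* p) ≡ + (p ℕ.^ b) * fall x b * G x b
    fall-p-split x zero = refl
    fall-p-split x (suc b) = begin
      fall (P * x) (p ℕ.+ b ℕ.* p)
        ≡⟨ fall-+ (P * x) p (b ℕ.* p) ⟩
      (P * x * W x) * fall (P * x - P) (b ℕ.* p)
        ≡⟨ cong (λ z → (P * x * W x) * fall z (b ℕ.* p)) (factor-p (+ p′) x) ⟩
      (P * x * W x) * fall (P * (x - 1ℤ)) (b ℕ.* p)
        ≡⟨ cong ((P * x * W x) *_) (fall-p-split (x - 1ℤ) b) ⟩
      (P * x * W x) * (+ (p ℕ.^ b) * fall (x - 1ℤ) b * G (x - 1ℤ) b)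
        ≡⟨ regroup P x (W x) (+ (p ℕ.^ b)) _ _ ⟩
      (P * + (p ℕ.^ b)) * fall x (suc b) * G x (suc b)
        ≡⟨ cong (λ z → z * fall x (suc b) * G x (suc b)) (sym (pos-* p (p ℕ.^ b))) ⟩
      + (p ℕ.^ suc b) * fall x (suc b) * G x (suc b) ∎
      where
      open ≡-Reasoning
      factor-p : ∀ a x → (1ℤ + a) * x - (1ℤ + a) ≡ (1ℤ + a) * (x - 1ℤ)
      factor-p = solve-∀
      regroup : ∀ P x w Pb f g → (P * x * w) * (Pb * f * g) ≡ (P * Pb) * (x * f) * (w * g)
      regroup = solve-∀

    factorial-p-split : ∀ b → + ((b ℕ.* p) !) ≡ + (p ℕ.^ b) * + (b !) * G (+ b) b
    factorial-p-split b = begin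
      + ((b ℕ.* p) !)                       ≡⟨ factorial-fall (b ℕ.* p) ⟩
      fall (+ (b ℕ.* p)) (b ℕ.* p)          ≡⟨ cong (λ z → fall z (b ℕ.* p)) (pos-*p b) ⟩
      fall (P * + b) (b ℕ.* p)              ≡⟨ fall-p-split (+ b) b ⟩
      + (p ℕ.^ b) * fall (+ b) b * G (+ b) b ≡⟨ cong (λ z → + (p ℕ.^ b) * z * G (+ b) b) (sym (factorial-fall b)) ⟩
      + (p ℕ.^ b) * + (b !) * G (+ b) b      ∎
      where open ≡-Reasoning

    -- Dividing the two splittings: C(p·a, p·b) · G b b = C(a, b) · G a b exactly.
    binom-p-exact : ∀ a b → binomℤ (P * a) (+ (b ℕ.* p)) * G (+ b) b ≡ binomℤ a (+ b) * G a b
    binom-p-exact a b = *-cancelˡ-≡ (p^b * b!) _ _ {{i*j≢0 p^b b! {{ℕP.m^n≢0 p b}} {{b ℕP.!≢0}}}} (begin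
      (p^b * b!) * (B₁ * G (+ b) b)              ≡⟨ regroup p^b b! B₁ (G (+ b) b) ⟩
      B₁ * (p^b * b! * G (+ b) b)                ≡⟨ cong (B₁ *_) (sym (factorial-p-split b)) ⟩
      B₁ * + ((b ℕ.* p) !)                       ≡⟨ binom-fall (P * a) (b ℕ.* p) ⟩
      fall (P * a) (b ℕ.* p)                     ≡⟨ fall-p-split a b ⟩
      p^b * fall a b * G a b                     ≡⟨ cong (λ z → p^b * z * G a b) (sym (binom-fall a b)) ⟩
      p^b * (B₀ * b!) * G a b                    ≡⟨ regroup′ p^b B₀ b! (G a b) ⟩
      (p^b * b!) * (B₀ * G a b)                  ∎)
      where
      open ≡-Reasoning
      p^b b! B₀ B₁ : ℤ
      p^b = + (p ℕ.^ b)
      b!  = + (b !)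
      B₀  = binomℤ a (+ b)
      B₁  = binomℤ (P * a) (+ (b ℕ.* p))
      regroup : ∀ q f B g → (q * f) * (B * g) ≡ B * (q * f * g)
      regroup = solve-∀
      regroup′ : ∀ q B f g → q * (B * f) * g ≡ (q * f) * (B * g)
      regroup′ = solve-∀

    scale-negative : ∀ m e → e ℕ.≤ p′ → P * -[1+ m ] + + e ≡ -[1+ (m ℕ.* p ℕ.+ (p′ ℕ.∸ e)) ]
    scale-negative m e e≤p′ = begin
      P * -[1+ m ] + + e                ≡⟨ cong (_+ + e) (sym (neg-distribʳ-* P (+ suc m))) ⟩
      - (P * + suc m) + + e             ≡⟨ cong (λ z → - z + + e) (sym (pos-*p (suc m))) ⟩
      - + (suc m ℕ.* p) + + e           ≡⟨ cong (λ z → - z + + e) (trans (cong +_ split) (pos-+ (suc K) e)) ⟩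
      - (+ suc K + + e) + + e           ≡⟨ neg-add-add (+ suc K) (+ e) ⟩
      -[1+ K ]                          ∎
      where
      open ≡-Reasoning
      K : ℕ
      K = m ℕ.* p ℕ.+ (p′ ℕ.∸ e)
      split : suc m ℕ.* p ≡ suc K ℕ.+ e
      split = cong suc (begin
        p′ ℕ.+ m ℕ.* p                      ≡⟨ ℕP.+-comm p′ (m ℕ.* p) ⟩
        m ℕ.* p ℕ.+ p′                      ≡⟨ cong (m ℕ.* p ℕ.+_) (sym (ℕP.m∸n+n≡m e≤p′)) ⟩
        m ℕ.* p ℕ.+ (p′ ℕ.∸ e ℕ.+ e)        ≡⟨ sym (ℕP.+-assoc (m ℕ.* p) (p′ ℕ.∸ e) e) ⟩
        K ℕ.+ e                             ∎)
      neg-add-add : ∀ k e → - (k + e) + e ≡ - k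
      neg-add-add = solve-∀

    scale-negative₀ : ∀ m → P * -[1+ m ] ≡ -[1+ (m ℕ.* p ℕ.+ p′) ]
    scale-negative₀ m = trans (sym (+-identityʳ _)) (scale-negative m 0 ℕ.z≤n)

    scaled-order : ∀ e {A B} → B ℕ.< A → B ℕ.* p ℕ.+ p′ ℕ.< A ℕ.* p ℕ.+ (p′ ℕ.∸ e)
    scaled-order e {A} {B} B<A = ℕP.<-≤-trans
      (ℕP.+-monoʳ-< (B ℕ.* p) (ℕP.n<1+n p′))
      (ℕP.≤-trans (subst (ℕ._≤ A ℕ.* p) (ℕP.+-comm p (B ℕ.* p)) (ℕP.*-monoˡ-≤ p B<A))
                  (ℕP.m≤m+n (A ℕ.* p) (p′ ℕ.∸ e)))

    reflected-index : ∀ {A B e} → A ℕ.≤ B → e ℕ.≤ p′ →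
      (B ℕ.* p ℕ.+ p′) ℕ.∸ (A ℕ.* p ℕ.+ (p′ ℕ.∸ e)) ≡ (B ℕ.∸ A) ℕ.* p ℕ.+ e
    reflected-index {A} {B} {e} A≤B e≤p′ = begin
      (B ℕ.* p ℕ.+ p′) ℕ.∸ Â                            ≡⟨ cong (ℕ._∸ Â) (sym sum) ⟩
      ((B ℕ.∸ A) ℕ.* p ℕ.+ e) ℕ.+ Â ℕ.∸ Â               ≡⟨ ℕP.m+n∸n≡m _ Â ⟩
      (B ℕ.∸ A) ℕ.* p ℕ.+ e                             ∎
      where
      open ≡-Reasoning
      Â : ℕ
      Â = A ℕ.* p ℕ.+ (p′ ℕ.∸ e)
      regroup : ∀ y p e a d → (y ℕ.* p ℕ.+ e) ℕ.+ (a ℕ.* p ℕ.+ d) ≡ (y ℕ.+ a) ℕ.* p ℕ.+ (e ℕ.+ d)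
      regroup = ℕSolver.solve-∀
      sum : ((B ℕ.∸ A) ℕ.* p ℕ.+ e) ℕ.+ Â ≡ B ℕ.* p ℕ.+ p′
      sum = trans (regroup (B ℕ.∸ A) p e A (p′ ℕ.∸ e))
                  (cong₂ (λ u v → u ℕ.* p ℕ.+ v) (ℕP.m∸n+n≡m A≤B) (ℕP.m+[n∸m]≡n e≤p′))

    reflected-difference : ∀ {A B} → A ℕ.≤ B → -[1+ A ] - + (B ℕ.∸ A) ≡ -[1+ B ]
    reflected-difference {A} {B} A≤B = begin
      -[1+ A ] - + (B ℕ.∸ A)               ≡⟨ neg-sum (+ suc A) (+ (B ℕ.∸ A)) ⟩
      - (+ suc A + + (B ℕ.∸ A))            ≡⟨ cong -_ (sym (pos-+ (suc A) (B ℕ.∸ A))) ⟩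
      - + suc (A ℕ.+ (B ℕ.∸ A))            ≡⟨ cong (λ m → - + suc m) (ℕP.m+[n∸m]≡n A≤B) ⟩
      -[1+ B ]                             ∎
      where
      open ≡-Reasoning
      neg-sum : ∀ a b → - a - b ≡ - (a + b)
      neg-sum = solve-∀

    -- Congruences modulo N = p·n, where n = p^r′

    module Periodicity (r′ : ℕ) where

      n N : ℕ
      n = p ℕ.^ r′
      N = p ℕ.^ suc r′

      cancel : ∀ {x y u} → x * u ≡ y * u mod + N → ¬ (P ∣ u) → x ≡ y mod + N
      cancel = mod-cancel {j = suc r′} pp

      scale-by-p : ∀ {x y} → x ≡ y mod + n → P * x ≡ P * y mod + N
      scale-by-p x≡y = subst (λ m → _ ≡ _ mod m) (sym (pos-* p n)) (mod-scale P x≡y)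

      W-mod : ∀ {q q′} → q ≡ q′ mod + n → W q ≡ W q′ mod + N
      W-mod q≡q′ = fall-mod p′ (mod-- (scale-by-p q≡q′) mod-refl)

      G-mod : ∀ {x x′} b → x ≡ x′ mod + n → G x b ≡ G x′ b mod + N
      G-mod zero    x≡x′ = mod-refl
      G-mod (suc b) x≡x′ = mod-* (W-mod x≡x′) (G-mod b (mod-- x≡x′ mod-refl))

      -- If n ∣ b, the window W x ⋯ W (x-b+1) runs over b/n full periods, so shifting it
      -- by one changes nothing: compare the two ends of G (1+x) (b+1).
      G-shift : ∀ {b} → + b ≡ 0ℤ mod + n → ∀ x → G (1ℤ + x) b ≡ G x b mod + N
      G-shift {b} n∣b x = cancel shifted (W-prime-to-p (1ℤ + x))
        where
        inc-dec : ∀ x → 1ℤ + x - 1ℤ ≡ x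
        inc-dec = solve-∀
        two-ends : W (1ℤ + x) * G x b ≡ G (1ℤ + x) b * W (1ℤ + x - + b)
        two-ends = trans (cong (λ y → W (1ℤ + x) * G y b) (sym (inc-dec x))) (G-last (1ℤ + x) b)
        far-end : W (1ℤ + x - + b) ≡ W (1ℤ + x) mod + N
        far-end = W-mod (mod-trans (mod-- (mod-refl {x = 1ℤ + x}) n∣b) (≡⇒≡-mod (+-identityʳ (1ℤ + x))))
        shifted : G (1ℤ + x) b * W (1ℤ + x) ≡ G x b * W (1ℤ + x) mod + N
        shifted = mod-trans (mod-*ˡ (G (1ℤ + x) b) (mod-sym far-end))
                            (≡⇒≡-mod (trans (sym two-ends) (*-comm (W (1ℤ + x)) (G x b))))

      G-const : ∀ {b} → + b ≡ 0ℤ mod + n → ∀ x → G x b ≡ G 0ℤ b mod + N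
      G-const n∣b (+ zero)     = mod-refl
      G-const n∣b (+ suc m)    = mod-trans (G-shift n∣b (+ m)) (G-const n∣b (+ m))
      G-const n∣b -[1+ zero ]  = mod-sym (G-shift n∣b -[1+ zero ])
      G-const n∣b -[1+ suc m ] = mod-trans (mod-sym (G-shift n∣b -[1+ suc m ])) (G-const n∣b -[1+ m ])

      G-agree : ∀ a b → (+ b ≡ 0ℤ mod + n) ⊎ (a ≡ + b mod + n) → G a b ≡ G (+ b) b mod + N
      G-agree a b (inj₁ n∣b) = mod-trans (G-const n∣b a) (mod-sym (G-const n∣b (+ b)))
      G-agree a b (inj₂ a≡b) = G-mod b a≡b

      binom-p-mod : ∀ a b → (+ b ≡ 0ℤ mod + n) ⊎ (a ≡ + b mod + n) →
        binomℤ (P * a) (+ (b ℕ.* p)) ≡ binomℤ a (+ b) mod + N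
      binom-p-mod a b hyp = cancel
        (mod-trans (≡⇒≡-mod (binom-p-exact a b)) (mod-*ˡ (binomℤ a (+ b)) (G-agree a b hyp)))
        (G-prime-to-p (+ b) b)

      binom-top-offset : ∀ a b e → e ℕ.< p → + b ≡ 0ℤ mod + n →
        binomℤ (P * a + + e) (+ (b ℕ.* p)) ≡ binomℤ (P * a) (+ (b ℕ.* p)) mod + N
      binom-top-offset a b e e<p n∣b = cancel shifted (prime-to-fall pp a e e<p)
        where
        x : ℤ
        x = P * a + + e
        pb≡0 : + (b ℕ.* p) ≡ 0ℤ mod + N
        pb≡0 = subst₂ (λ u v → u ≡ v mod + N) (sym (pos-*p b)) (*-zeroʳ P) (scale-by-p n∣b)
        near-top : fall (x - + (b ℕ.* p)) e ≡ fall x e mod + N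
        near-top = fall-mod e (mod-trans (mod-- (mod-refl {x = x}) pb≡0) (≡⇒≡-mod (+-identityʳ x)))
        shifted : binomℤ x (+ (b ℕ.* p)) * fall x e ≡ binomℤ (P * a) (+ (b ℕ.* p)) * fall x e mod + N
        shifted = mod-trans (mod-*ˡ (binomℤ x (+ (b ℕ.* p))) (mod-sym near-top))
                            (≡⇒≡-mod (binom-top-shift (P * a) (b ℕ.* p) e))

      binom-both-offset : ∀ a Y e → e ℕ.< p → a ≡ + Y mod + n →
        binomℤ (P * a + + e) (+ (Y ℕ.* p ℕ.+ e)) ≡ binomℤ (P * a) (+ (Y ℕ.* p)) mod + N
      binom-both-offset a Y e e<p a≡Y = cancel shifted (prime-to-fall pp a e e<p)
        where
        x : ℤ
        x = P * a + + e
        bottom≡top : fall (+ (Y ℕ.* p ℕ.+ e)) e ≡ fall x e mod + N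
        bottom≡top = fall-mod e (subst (λ z → z ≡ x mod + N)
                                   (sym (trans (pos-+ (Y ℕ.* p) e) (cong (_+ + e) (pos-*p Y))))
                                   (mod-+ (scale-by-p (mod-sym a≡Y)) mod-refl))
        shifted : binomℤ x (+ (Y ℕ.* p ℕ.+ e)) * fall x e ≡ binomℤ (P * a) (+ (Y ℕ.* p)) * fall x e mod + N
        shifted = mod-trans (mod-*ˡ (binomℤ x (+ (Y ℕ.* p ℕ.+ e))) (mod-sym bottom≡top))
                            (≡⇒≡-mod (binom-both-shift (P * a) (Y ℕ.* p) e))

      -- Negative top and negative bottom: either both binomials vanish, or reflecting
      -- both turns the claim into binom-both-offset followed by binom-p-mod.
      core-negative : ∀ A B e → e ℕ.< p → -[1+ B ] ≡ 0ℤ mod + n →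
        binomℤ (P * -[1+ A ] + + e) (P * -[1+ B ]) ≡ binomℤ -[1+ A ] -[1+ B ] mod + N
      core-negative A B e e<p n∣K with B ℕP.<? A
      ... | yes B<A = ≡⇒≡-mod (begin
        binomℤ (P * -[1+ A ] + + e) (P * -[1+ B ])
          ≡⟨ cong₂ binomℤ (scale-negative A e (ℕP.≤-pred e<p)) (scale-negative₀ B) ⟩
        binomℤ -[1+ (A ℕ.* p ℕ.+ (p′ ℕ.∸ e)) ] -[1+ (B ℕ.* p ℕ.+ p′) ]
          ≡⟨ binom-neg-vanish _ _ (scaled-order e B<A) ⟩
        0ℤ
          ≡⟨ sym (binom-neg-vanish A B B<A) ⟩
        binomℤ -[1+ A ] -[1+ B ] ∎)
        where open ≡-Reasoning
      ... | no B≮A = begin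
        binomℤ (P * -[1+ A ] + + e) (P * -[1+ B ])
          ≡⟨ cong₂ binomℤ (scale-negative A e e≤p′) (scale-negative₀ B) ⟩
        binomℤ -[1+ Â ] -[1+ (B ℕ.* p ℕ.+ p′) ]
          ≡⟨ binom-neg-reflect Â _ Â≤B̂ ⟩
        binomℤ -[1+ Â ] (+ ((B ℕ.* p ℕ.+ p′) ℕ.∸ Â))
          ≡⟨ cong₂ binomℤ (sym (scale-negative A e e≤p′)) (cong +_ (reflected-index A≤B e≤p′)) ⟩
        binomℤ (P * -[1+ A ] + + e) (+ (Y ℕ.* p ℕ.+ e))
          ≈⟨ binom-both-offset -[1+ A ] Y e e<p T≡Y ⟩
        binomℤ (P * -[1+ A ]) (+ (Y ℕ.* p))
          ≈⟨ binom-p-mod -[1+ A ] Y (inj₂ T≡Y) ⟩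
        binomℤ -[1+ A ] (+ Y)
          ≡⟨ sym (binom-neg-reflect A B A≤B) ⟩
        binomℤ -[1+ A ] -[1+ B ] ∎
        where
        open SetoidReasoning (mod-setoid (+ N))
        e≤p′ : e ℕ.≤ p′
        e≤p′ = ℕP.≤-pred e<p
        A≤B : A ℕ.≤ B
        A≤B = ℕP.≮⇒≥ B≮A
        Y Â : ℕ
        Y = B ℕ.∸ A
        Â = A ℕ.* p ℕ.+ (p′ ℕ.∸ e)
        Â≤B̂ : Â ℕ.≤ B ℕ.* p ℕ.+ p′
        Â≤B̂ = ℕP.+-mono-≤ (ℕP.*-monoˡ-≤ p A≤B) (ℕP.m∸n≤m p′ e)
        T≡Y : -[1+ A ] ≡ + Y mod + n
        T≡Y = difference-mod (reflected-difference A≤B) n∣K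

      core : ∀ T K e → e ℕ.< p → K ≡ 0ℤ mod + n → binomℤ (P * T + + e) (P * K) ≡ binomℤ T K mod + N
      core T (+ b) e e<p n∣b = begin
        binomℤ (P * T + + e) (P * + b)       ≡⟨ cong (binomℤ (P * T + + e)) (sym (pos-*p b)) ⟩
        binomℤ (P * T + + e) (+ (b ℕ.* p))   ≈⟨ binom-top-offset T b e e<p n∣b ⟩
        binomℤ (P * T) (+ (b ℕ.* p))         ≈⟨ binom-p-mod T b (inj₁ n∣b) ⟩
        binomℤ T (+ b)                       ∎
        where open SetoidReasoning (mod-setoid (+ N))
      -- a non-negative top over a negative bottom: both binomials are 0
      core (+ a) -[1+ B ] e _ _ = ≡⇒≡-mod (cong (λ x → binomℤ x (P * -[1+ B ])) top)
        where
        top : P * + a + + e ≡ + (a ℕ.* p ℕ.+ e)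
        top = trans (cong (_+ + e) (sym (pos-*p a))) (sym (pos-+ (a ℕ.* p) e))
      core -[1+ A ] -[1+ B ] e e<p n∣K = core-negative A B e e<p n∣K

      -- The binomials of the theorem have the shape treated by `core`: writing
      -- k = s + t·p with 0 ≤ s < p, the top is p·T + (p-1-s) with T = n·m₁ + n·m₂ - t - 1
      -- and the bottom is p·(n·m₁).
      binom-pʳ-mod : ∀ m₁ m₂ k →
        binomℤ (+ N * m₁ + + N * m₂ - k - 1ℤ) (+ N * m₁)
          ≡ binomℤ (+ n * m₁ + + n * m₂ - k /ℕ p - 1ℤ) (+ n * m₁) mod + N
      binom-pʳ-mod m₁ m₂ k =
        subst₂ (λ u v → binomℤ u v ≡ binomℤ T (+ n * m₁) mod + N) (sym top) (sym bottom)
               (core T (+ n * m₁) e e<p (∣⇒≡0-mod (∣m⇒∣m*n m₁ ∣-refl)))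
        where
        s : ℕ
        s = k %ℕ p
        t T : ℤ
        t = k /ℕ p
        T = + n * m₁ + + n * m₂ - t - 1ℤ
        e : ℕ
        e = p′ ℕ.∸ s
        e<p : e ℕ.< p
        e<p = ℕ.s≤s (ℕP.m∸n≤m p′ s)
        N≡Pn : + N ≡ P * + n
        N≡Pn = pos-* p n
        regroup : ∀ a n m₁ m₂ s t →
          ((1ℤ + a) * n) * m₁ + ((1ℤ + a) * n) * m₂ - (s + t * (1ℤ + a)) - 1ℤ
            ≡ (1ℤ + a) * (n * m₁ + n * m₂ - t - 1ℤ) + (a - s)
        regroup = solve-∀
        top : + N * m₁ + + N * m₂ - k - 1ℤ ≡ P * T + + e
        top = begin
          + N * m₁ + + N * m₂ - k - 1ℤ
            ≡⟨ cong₂ (λ z k → z * m₁ + z * m₂ - k - 1ℤ) N≡Pn (a≡a%ℕn+[a/ℕn]*n k p) ⟩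
          (P * + n) * m₁ + (P * + n) * m₂ - (+ s + t * P) - 1ℤ
            ≡⟨ regroup (+ p′) (+ n) m₁ m₂ (+ s) t ⟩
          P * T + (+ p′ - + s)
            ≡⟨ cong (_+_ (P * T)) (trans (m-n≡m⊖n p′ s) (⊖-≥ (ℕP.≤-pred (n%ℕd<d k p)))) ⟩
          P * T + + e ∎
          where open ≡-Reasoning
        bottom : + N * m₁ ≡ P * (+ n * m₁)
        bottom = trans (cong (_* m₁) N≡Pn) (*-assoc P (+ n) m₁)

open import Data.Nat using (ℕ; _≤_)
open import Data.Nat.Primality using (Prime; prime⇒nonZero)
open import Data.Integer using (ℤ; +_; _+_; _-_; _*_; -_; 1ℤ)
open import Data.Integer.DivMod using (_/ℕ_)
open import Data.Integer.Divisibility using (_∣_)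
open import Data.Integer.Divisibility.Signed using (∣⇒∣ᵤ)
open import Data.Empty using (⊥-elim)
import Data.Nat as ℕ

lemma5p5 : (p : ℕ) (pp : Prime p) (m₁ m₂ k : ℤ) (r : ℕ) → 1 ≤ r →
    (+ (p ℕ.^ r)) ∣
      (binomℤ (+ (p ℕ.^ r) * m₁ + + (p ℕ.^ r) * m₂ - k - 1ℤ) (+ (p ℕ.^ r) * m₁)
       - binomℤ (+ (p ℕ.^ (r ℕ.∸ 1)) * m₁ + + (p ℕ.^ (r ℕ.∸ 1)) * m₂ - _/ℕ_ k p {{prime⇒nonZero pp}} - 1ℤ)
                (+ (p ℕ.^ (r ℕ.∸ 1)) * m₁))
lemma5p5 ℕ.zero pp _ _ _ _ _ = ⊥-elim (ℕ.NonZero.nonZero (prime⇒nonZero pp))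
lemma5p5 (ℕ.suc p′) pp _ _ _ ℕ.zero ()
lemma5p5 (ℕ.suc p′) pp m₁ m₂ k (ℕ.suc r′) _ =
  ∣⇒∣ᵤ (BinomialCongruence._≡_mod_.difference (binom-pʳ-mod m₁ m₂ k))
  where open BinomialCongruence.Splitting pp using (module Periodicity)
        open Periodicity r′ using (binom-pʳ-mod)
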